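{- Let $G$ be a $\Sigma$-edge-colored ordered graph on $n\ge q$ vertices and let $k\ge q$. Then the variation distance between the $q$-statistic of $G$ and the $(q,k)$-statistic of $G$ is at most $q^2/(2k)$.
   Context: A $\Sigma$-edge-colored ordered graph is $G\colon\binom{[n]}2\to\Sigma$. $\mathcal{H}_q$ is the family of all $\Sigma$-edge-colored ordered graphs on vertex set $[q]$. For $H\in\mathcal{H}_q$, a copy of $H$ in $G$ is a $q$-subset of $[n]$ whose induced ordered subgraph (relabeled order-preservingly by $[q]$) equals $H$; $t(H,G)$ is the number of copies divided by $\binom nq$, and the $q$-statistic of $G$ is the distribution $(t(H,G))_{H\in\mathcal{H}_q}$. Let $I_1,\dots,I_k$ be the $k$-interval equipartition of $[n]$ (consecutive intervals with $|I_{i'}|\le|I_i|\le|I_{i'}|+1$ for $i<i'$). A $q$-subset is $k$-separated if no two of its elements lie in the same $I_i$; $N(k,q,n)$ is the number of $k$-separated $q$-subsets; $t_k(H,G)$ is the number of $k$-separated copies of $H$ divided by $N(k,q,n)$, and the $(q,k)$-statistic is $(t_k(H,G))_{H\in\mathcal{H}_q}$. Variation distance between distributions $\mu,\nu$ is $\frac12\sum_H|\mu(H)-\nu(H)|$. -}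

module Defs where

open import Data.Nat as ℕ using (ℕ; zero; suc; _+_; _*_; _∸_; _/_; _%_; _<ᵇ_; NonZero)
open import Data.Nat.Combinatorics using (_C_)
open import Data.Fin as Fin using (Fin)
open import Data.Bool using (Bool; true; false; if_then_else_; _∧_; not)
open import Data.List using (List; []; _∷_; _++_; map; concatMap; allFin; length; filterᵇ; replicate; foldr; _∷ʳ_)
open import Data.List.Properties using (≡-dec)
open import Data.Bool.ListAction using (all)
open import Data.Product using (_×_; _,_)
open import Data.Integer using (+_)
open import Data.Rational as ℚ using (ℚ; 0ℚ; ½; ∣_∣)
open import Relation.Nullary using (does)

-- Σ is the finite colour set Fin s.
-- A Σ-edge-coloured ordered graph on [n] = {0,…,n-1}: only the values G a b with a < b < n matter.
ColGraph : ℕ → Set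
ColGraph s = ℕ → ℕ → Fin s

-- All q-subsets of {0,…,n-1}, each as a strictly increasing list.
subsets : ℕ → ℕ → List (List ℕ)
subsets zero    n       = [] ∷ []
subsets (suc q) zero    = []
subsets (suc q) (suc n) = subsets (suc q) n ++ map (_∷ʳ n) (subsets q n)

pairs : List ℕ → List (ℕ × ℕ)
pairs []       = []
pairs (x ∷ xs) = map (x ,_) xs ++ pairs xs

-- An ordered graph on [q] is encoded by its colours on the pairs of [q] in lexicographic order:
-- a word of length (q C 2) over Fin s.  `words s m` lists all words of length m (each once).
words : (s : ℕ) → ℕ → List (List (Fin s))
words s zero    = [] ∷ []
words s (suc m) = concatMap (λ c → map (c ∷_) (words s m)) (allFin s)

𝓗 : (s q : ℕ) → List (List (Fin s))
𝓗 s q = words s (q C 2)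

-- The induced ordered subgraph of G on a q-subset xs (relabelled order-preservingly by [q]).
induced : ∀ {s} → ColGraph s → List ℕ → List (Fin s)
induced G xs = map (λ { (a , b) → G a b }) (pairs xs)

isCopy : ∀ {s} → ColGraph s → List (Fin s) → List ℕ → Bool
isCopy G H xs = does (≡-dec Fin._≟_ (induced G xs) H)

-- Safe division of naturals into ℚ (denominator 0 ↦ 0; never used with 0 under the hypotheses).
frac : ℕ → ℕ → ℚ
frac a zero    = 0ℚ
frac a (suc b) = (+ a) ℚ./ suc b

-- Interval sizes of the k-interval equipartition of [n]:
-- the first (n % k) intervals have size ⌊n/k⌋+1, the remaining ones size ⌊n/k⌋.
intervalSizes : (k n : ℕ) → .{{NonZero k}} → List ℕ
intervalSizes k n = replicate (n % k) (suc (n / k)) ++ replicate (k ∸ n % k) (n / k)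

blockOf : List ℕ → ℕ → ℕ
blockOf []         v = 0
blockOf (sz ∷ szs) v = if v <ᵇ sz then 0 else suc (blockOf szs (v ∸ sz))

block : (k n : ℕ) → .{{NonZero k}} → ℕ → ℕ
block k n v = blockOf (intervalSizes k n) v

separated : (k n : ℕ) → .{{NonZero k}} → List ℕ → Bool
separated k n xs = all (λ { (a , b) → not (does (block k n a ℕ.≟ block k n b)) }) (pairs xs)

sepSubsets : (k q n : ℕ) → .{{NonZero k}} → List (List ℕ)
sepSubsets k q n = filterᵇ (separated k n) (subsets q n)

N : (k q n : ℕ) → .{{NonZero k}} → ℕ
N k q n = length (sepSubsets k q n)

t : ∀ {s} (q n : ℕ) → List (Fin s) → ColGraph s → ℚ
t q n H G = frac (length (filterᵇ (isCopy G H) (subsets q n))) (n C q)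

tk : ∀ {s} (k q n : ℕ) → .{{NonZero k}} → List (Fin s) → ColGraph s → ℚ
tk k q n H G = frac (length (filterᵇ (isCopy G H) (sepSubsets k q n))) (N k q n)

sumℚ : List ℚ → ℚ
sumℚ = foldr ℚ._+_ 0ℚ

statDist : ∀ {s} (k q n : ℕ) → .{{NonZero k}} → ColGraph s → ℚ
statDist {s} k q n G = ½ ℚ.* sumℚ (map (λ H → ∣ t q n H G ℚ.- tk k q n H G ∣) (𝓗 s q))

-- Split the q-subsets S of [n] into the k-separated ones and the rest R, and write the number of
-- copies of H in S as a_H + b_H accordingly. Every subset is a copy of only one H, so Σ a_H ≤ |S| − |R|
-- and Σ b_H ≤ |R|; comparing (a_H + b_H)/|S| with a_H/(|S| − |R|) term by term then bounds the
-- variation distance by |R|/|S|. A subset in R contains two elements of one interval; each such pair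
-- lies in C(n−2, q−2) q-subsets, and a k-interval equipartition of [n] has at most n(n−1)/(2k) of
-- them, so |R| ≤ n(n−1)/(2k) · C(n−2, q−2) = q(q−1)/(2k) · C(n, q).

module Submission where

open import Defs
open import Data.Nat using (ℕ; _≤_; _*_; NonZero)
open import Data.Rational using (ℚ) renaming (_≤_ to _≤ℚ_)

open import Data.Bool using (Bool; true; false; if_then_else_; not; T?)
open import Data.Bool.ListAction using (all)
open import Data.Bool.Properties using (T-≡; not-involutive)
open import Data.Fin as Fin using (Fin)
open import Data.Integer as ℤ using (_⊖_; +≤+)
import Data.Integer.Properties as ℤP
open import Data.List
  using (List; []; _∷_; _++_; _∷ʳ_; map; concatMap; allFin; length; filterᵇ; tabulate; replicate)
open import Data.List.Properties
  using (≡-dec; length-filter; filter-++; length-++; length-map; map-++; map-∘; map-tabulate; map-replicate)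
open import Data.Nat using (zero; suc; _+_; _∸_; _<_; _<ᵇ_; _/_; _%_; z≤n; s≤s; >-nonZero⁻¹)
open import Data.Nat.Combinatorics using (_C_; nC1≡n; nCk+nC[k+1]≡[n+1]C[k+1])
open import Data.Nat.DivMod using (m≡m%n+[m/n]*n; m%n<n)
open import Data.Nat.ListAction using (sum)
open import Data.Nat.ListAction.Properties using (sum-++)
open import Data.Nat.Properties
open import Data.Nat.Tactic.RingSolver using (solve-∀)
open import Data.Product using (_,_; uncurry)
open import Data.Rational as ℚ using (½; toℚᵘ)
import Data.Rational.Properties as ℚP
open import Data.Rational.Unnormalised as ℚᵘ using (mkℚᵘ; *≤*; *≡*)
import Data.Rational.Unnormalised.Properties as ℚᵘP
open import Data.Sum using (inj₁; inj₂)
open import Function using (_∘_; id)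
open import Function.Bundles using (Equivalence)
open import Relation.Binary.PropositionalEquality
open import Relation.Nullary using (does; yes; no)

open import Algebra.Properties.CommutativeSemigroup +-commutativeSemigroup
  using () renaming (x∙yz≈y∙xz to +-exchange; interchange to +-interchange)
open import Algebra.Properties.CommutativeSemigroup *-commutativeSemigroup
  using () renaming (x∙yz≈y∙xz to *-exchange)

private variable A B : Set

count : (A → Bool) → List A → ℕ
count p xs = length (filterᵇ p xs)

indicator : Bool → ℕ
indicator b = if b then 1 else 0

count-∷ : ∀ (p : A → Bool) x xs → count p (x ∷ xs) ≡ indicator (p x) + count p xs
count-∷ p x xs with p x
... | true  = refl
... | false = refl

count-≤-length : ∀ (p : A → Bool) xs → count p xs ≤ length xs
count-≤-length p = length-filter (T? ∘ p)

count-++ : ∀ (p : A → Bool) xs ys → count p (xs ++ ys) ≡ count p xs + count p ys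
count-++ p xs ys = trans (cong length (filter-++ (T? ∘ p) xs ys)) (length-++ (filterᵇ p xs))

count-∷ʳ : ∀ (p : A → Bool) xs y → count p (xs ∷ʳ y) ≡ count p xs + indicator (p y)
count-∷ʳ p xs y = trans (count-++ p xs (y ∷ [])) (cong (count p xs +_) (trans (count-∷ p y []) (+-identityʳ (indicator (p y)))))

count-cong : ∀ {p q : A → Bool} → (∀ x → p x ≡ q x) → ∀ xs → count p xs ≡ count q xs
count-cong p≗q []       = refl
count-cong {p = p} {q} p≗q (x ∷ xs) = begin
  count p (x ∷ xs)                ≡⟨ count-∷ p x xs ⟩
  indicator (p x) + count p xs    ≡⟨ cong₂ _+_ (cong indicator (p≗q x)) (count-cong p≗q xs) ⟩
  indicator (q x) + count q xs    ≡⟨ count-∷ q x xs ⟨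
  count q (x ∷ xs)                ∎
  where open ≡-Reasoning

count-false : ∀ (xs : List A) → count (λ _ → false) xs ≡ 0
count-false []       = refl
count-false (x ∷ xs) = count-false xs

count-true : ∀ (xs : List A) → count (λ _ → true) xs ≡ length xs
count-true []       = refl
count-true (x ∷ xs) = cong suc (count-true xs)

count-map : ∀ (p : B → Bool) (f : A → B) xs → count p (map f xs) ≡ count (p ∘ f) xs
count-map p f []       = refl
count-map p f (x ∷ xs) = begin
  count p (f x ∷ map f xs)                  ≡⟨ count-∷ p (f x) (map f xs) ⟩
  indicator (p (f x)) + count p (map f xs)  ≡⟨ cong (indicator (p (f x)) +_) (count-map p f xs) ⟩
  indicator (p (f x)) + count (p ∘ f) xs    ≡⟨ count-∷ (p ∘ f) x xs ⟨
  count (p ∘ f) (x ∷ xs)                    ∎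
  where open ≡-Reasoning

count-concatMap : ∀ (p : B → Bool) (f : A → List B) xs →
  count p (concatMap f xs) ≡ sum (map (count p ∘ f) xs)
count-concatMap p f []       = refl
count-concatMap p f (x ∷ xs) =
  trans (count-++ p (f x) (concatMap f xs)) (cong (count p (f x) +_) (count-concatMap p f xs))

count-filter-split : ∀ (p g : A → Bool) xs →
  count p xs ≡ count p (filterᵇ g xs) + count p (filterᵇ (not ∘ g) xs)
count-filter-split p g []       = refl
count-filter-split p g (x ∷ xs) with g x
... | true  = begin
  count p (x ∷ xs)                                  ≡⟨ count-∷ p x xs ⟩
  indicator (p x) + count p xs                      ≡⟨ cong (indicator (p x) +_) (count-filter-split p g xs) ⟩
  indicator (p x) + (count p gs + count p bs)       ≡⟨ +-assoc (indicator (p x)) _ _ ⟨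
  (indicator (p x) + count p gs) + count p bs       ≡⟨ cong (_+ count p bs) (count-∷ p x gs) ⟨
  count p (x ∷ gs) + count p bs                     ∎
  where open ≡-Reasoning
        gs = filterᵇ g xs
        bs = filterᵇ (not ∘ g) xs
... | false = begin
  count p (x ∷ xs)                                  ≡⟨ count-∷ p x xs ⟩
  indicator (p x) + count p xs                      ≡⟨ cong (indicator (p x) +_) (count-filter-split p g xs) ⟩
  indicator (p x) + (count p gs + count p bs)       ≡⟨ +-exchange (indicator (p x)) (count p gs) (count p bs) ⟩
  count p gs + (indicator (p x) + count p bs)       ≡⟨ cong (count p gs +_) (count-∷ p x bs) ⟨
  count p gs + count p (x ∷ bs)                     ∎
  where open ≡-Reasoning
        gs = filterᵇ g xs
        bs = filterᵇ (not ∘ g) xs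

length-filter-split : ∀ (g : A → Bool) xs → length xs ≡ count g xs + count (not ∘ g) xs
length-filter-split g xs = begin
  length xs                                    ≡⟨ count-true xs ⟨
  count (λ _ → true) xs                        ≡⟨ count-filter-split (λ _ → true) g xs ⟩
  count (λ _ → true) (filterᵇ g xs) + count (λ _ → true) (filterᵇ (not ∘ g) xs)
                                               ≡⟨ cong₂ _+_ (count-true (filterᵇ g xs)) (count-true (filterᵇ (not ∘ g) xs)) ⟩
  count g xs + count (not ∘ g) xs              ∎
  where open ≡-Reasoning

sum-map-cong : ∀ {f g : A → ℕ} → (∀ x → f x ≡ g x) → ∀ xs → sum (map f xs) ≡ sum (map g xs)
sum-map-cong f≗g []       = refl
sum-map-cong f≗g (x ∷ xs) = cong₂ _+_ (f≗g x) (sum-map-cong f≗g xs)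

sum-map-+ : ∀ (f g : A → ℕ) xs → sum (map (λ x → f x + g x) xs) ≡ sum (map f xs) + sum (map g xs)
sum-map-+ f g []       = refl
sum-map-+ f g (x ∷ xs) = trans (cong (f x + g x +_) (sum-map-+ f g xs)) (+-interchange (f x) (g x) _ _)

sum-map-*ʳ : ∀ (f : A → ℕ) c xs → sum (map (λ x → f x * c) xs) ≡ sum (map f xs) * c
sum-map-*ʳ f c []       = refl
sum-map-*ʳ f c (x ∷ xs) = trans (cong (f x * c +_) (sum-map-*ʳ f c xs)) (sym (*-distribʳ-+ c (f x) _))

sum-map-const : ∀ c (xs : List A) → sum (map (λ _ → c) xs) ≡ length xs * c
sum-map-const c []       = refl
sum-map-const c (x ∷ xs) = cong (c +_) (sum-map-const c xs)

sum-map-zero : ∀ xs → sum (map (λ (_ : A) → 0) xs) ≡ 0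
sum-map-zero []       = refl
sum-map-zero (x ∷ xs) = sum-map-zero xs

sum-replicate : ∀ a x → sum (replicate a x) ≡ a * x
sum-replicate zero    x = refl
sum-replicate (suc a) x = cong (x +_) (sum-replicate a x)

sum-map-indicator : ∀ (p : A → Bool) xs → sum (map (indicator ∘ p) xs) ≡ count p xs
sum-map-indicator p []       = refl
sum-map-indicator p (x ∷ xs) =
  trans (cong (indicator (p x) +_) (sum-map-indicator p xs)) (sym (count-∷ p x xs))

count-≤-sum : ∀ {f : A → Bool} {g : A → ℕ} → (∀ x → indicator (f x) ≤ g x) → ∀ xs → count f xs ≤ sum (map g xs)
count-≤-sum f≤g []       = z≤n
count-≤-sum {f = f} f≤g (x ∷ xs) = ≤-trans (≤-reflexive (count-∷ f x xs)) (+-mono-≤ (f≤g x) (count-≤-sum f≤g xs))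

not-all-≤-count : ∀ (p : A → Bool) xs → indicator (not (all p xs)) ≤ count (not ∘ p) xs
not-all-≤-count p []       = z≤n
not-all-≤-count p (x ∷ xs) with p x
... | true  = not-all-≤-count p xs
... | false = s≤s z≤n

sum-count-≤-length : ∀ (p : B → A → Bool) (Hs : List B) xs →
  (∀ x → count (λ H → p H x) Hs ≤ 1) → sum (map (λ H → count (p H) xs) Hs) ≤ length xs
sum-count-≤-length p Hs []       _  = ≤-reflexive (sum-map-zero Hs)
sum-count-≤-length p Hs (x ∷ xs) ≤1 = begin
  sum (map (λ H → count (p H) (x ∷ xs)) Hs)
    ≡⟨ sum-map-cong (λ H → count-∷ (p H) x xs) Hs ⟩
  sum (map (λ H → indicator (p H x) + count (p H) xs) Hs)
    ≡⟨ sum-map-+ (λ H → indicator (p H x)) (λ H → count (p H) xs) Hs ⟩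
  sum (map (λ H → indicator (p H x)) Hs) + sum (map (λ H → count (p H) xs) Hs)
    ≡⟨ cong (_+ _) (sum-map-indicator (λ H → p H x) Hs) ⟩
  count (λ H → p H x) Hs + sum (map (λ H → count (p H) xs) Hs)
    ≤⟨ +-mono-≤ (≤1 x) (sum-count-≤-length p Hs xs ≤1) ⟩
  suc (length xs) ∎
  where open ≤-Reasoning

sum-allFin-if-≟ : ∀ {t} (c₀ : Fin t) X → sum (map (λ c → if does (c₀ Fin.≟ c) then X else 0) (allFin t)) ≡ X
sum-allFin-if-≟ {suc t} c₀ X =
  trans (cong sum (map-tabulate id (λ c → if does (c₀ Fin.≟ c) then X else 0))) (sum-tabulate c₀)
  where
  sum-tabulate-zero : ∀ t → sum (tabulate {n = t} (λ _ → 0)) ≡ 0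
  sum-tabulate-zero zero    = refl
  sum-tabulate-zero (suc t) = sum-tabulate-zero t
  sum-tabulate : ∀ {t} (c₀ : Fin t) → sum (tabulate (λ c → if does (c₀ Fin.≟ c) then X else 0)) ≡ X
  sum-tabulate {suc t} Fin.zero    = trans (cong (X +_) (sum-tabulate-zero t)) (+-identityʳ X)
  sum-tabulate         (Fin.suc c) = sum-tabulate c

module _ {s : ℕ} where

  _≡ʷ_ : List (Fin s) → List (Fin s) → Bool
  u ≡ʷ v = does (≡-dec Fin._≟_ u v)

  count-≡ʷ-cons : ∀ c₀ w c W →
    count (((c₀ ∷ w) ≡ʷ_) ∘ (c ∷_)) W ≡ (if does (c₀ Fin.≟ c) then count (w ≡ʷ_) W else 0)
  count-≡ʷ-cons c₀ w c W with c₀ Fin.≟ c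
  ... | yes _ = refl
  ... | no  _ = count-false W

  count-≡ʷ-words-≤1 : ∀ m w → count (w ≡ʷ_) (words s m) ≤ 1
  count-≡ʷ-words-≤1 zero    w        = count-≤-length (w ≡ʷ_) (words s zero)
  count-≡ʷ-words-≤1 (suc m) []       = ≤-trans (≤-reflexive (begin
    count ([] ≡ʷ_) (words s (suc m))
      ≡⟨ count-concatMap ([] ≡ʷ_) (λ c → map (c ∷_) (words s m)) (allFin s) ⟩
    sum (map (λ c → count ([] ≡ʷ_) (map (c ∷_) (words s m))) (allFin s))
      ≡⟨ sum-map-cong (λ c → trans (count-map ([] ≡ʷ_) (c ∷_) (words s m)) (count-false (words s m))) (allFin s) ⟩
    sum (map (λ _ → 0) (allFin s))
      ≡⟨ sum-map-zero (allFin s) ⟩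
    0 ∎)) z≤n
    where open ≡-Reasoning
  count-≡ʷ-words-≤1 (suc m) (c₀ ∷ w) = ≤-trans (≤-reflexive (begin
    count ((c₀ ∷ w) ≡ʷ_) (words s (suc m))
      ≡⟨ count-concatMap ((c₀ ∷ w) ≡ʷ_) (λ c → map (c ∷_) (words s m)) (allFin s) ⟩
    sum (map (λ c → count ((c₀ ∷ w) ≡ʷ_) (map (c ∷_) (words s m))) (allFin s))
      ≡⟨ sum-map-cong (λ c → trans (count-map ((c₀ ∷ w) ≡ʷ_) (c ∷_) (words s m))
                                   (count-≡ʷ-cons c₀ w c (words s m))) (allFin s) ⟩
    sum (map (λ c → if does (c₀ Fin.≟ c) then count (w ≡ʷ_) (words s m) else 0) (allFin s))
      ≡⟨ sum-allFin-if-≟ c₀ _ ⟩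
    count (w ≡ʷ_) (words s m) ∎)) (count-≡ʷ-words-≤1 m w)
    where open ≡-Reasoning

-- Fractions

∣m⊖n∣≤o : ∀ {m n o} → m ≤ n + o → n ≤ m + o → ℤ.∣ m ⊖ n ∣ ≤ o
∣m⊖n∣≤o {m} {n} {o} m≤n+o n≤m+o with ≤-total m n
... | inj₁ m≤n = subst (_≤ o) (sym (ℤP.∣⊖∣-≤ m≤n)) (m≤n+o⇒m∸n≤o n m n≤m+o)
... | inj₂ n≤m = subst (_≤ o) (sym (trans (ℤP.∣m⊖n∣≡∣n⊖m∣ m n) (ℤP.∣⊖∣-≤ n≤m))) (m≤n+o⇒m∸n≤o m n m≤n+o)

toℚᵘ-frac : ∀ a b → toℚᵘ (frac a (suc b)) ℚᵘ.≃ mkℚᵘ (ℤ.+ a) b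
toℚᵘ-frac a b = ℚP.toℚᵘ-fromℚᵘ (mkℚᵘ (ℤ.+ a) b)

mkℚᵘ-≃ : ∀ {a b c d} → a * suc d ≡ c * suc b → mkℚᵘ (ℤ.+ a) b ℚᵘ.≃ mkℚᵘ (ℤ.+ c) d
mkℚᵘ-≃ {a} {b} {c} {d} ad≡cb = *≡* (trans (sym (ℤP.pos-* a (suc d))) (trans (cong ℤ.+_ ad≡cb) (ℤP.pos-* c (suc b))))

frac-mono-≤ : ∀ a b c d .{{_ : NonZero d}} → a * d ≤ c * b → frac a b ≤ℚ frac c d
frac-mono-≤ a zero    c (suc d) _     = ℚP.nonNegative⁻¹ (frac c (suc d)) {{ℚP.normalize-nonNeg c (suc d)}}
frac-mono-≤ a (suc b) c (suc d) ad≤cb = ℚP.toℚᵘ-cancel-≤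
  (ℚᵘP.≤-respˡ-≃ (ℚᵘP.≃-sym (toℚᵘ-frac a b)) (ℚᵘP.≤-respʳ-≃ (ℚᵘP.≃-sym (toℚᵘ-frac c d))
    (*≤* (subst₂ ℤ._≤_ (ℤP.pos-* a (suc d)) (ℤP.pos-* c (suc b)) (+≤+ ad≤cb)))))

frac-+ : ∀ a b D → frac a (suc D) ℚ.+ frac b (suc D) ≡ frac (a + b) (suc D)
frac-+ a b D = ℚP.toℚᵘ-injective (begin
  toℚᵘ (frac a (suc D) ℚ.+ frac b (suc D))             ≈⟨ ℚP.toℚᵘ-homo-+ (frac a (suc D)) (frac b (suc D)) ⟩
  toℚᵘ (frac a (suc D)) ℚᵘ.+ toℚᵘ (frac b (suc D))     ≈⟨ ℚᵘP.+-cong (toℚᵘ-frac a D) (toℚᵘ-frac b D) ⟩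
  mkℚᵘ (ℤ.+ a) D ℚᵘ.+ mkℚᵘ (ℤ.+ b) D                   ≡⟨ cong (λ z → mkℚᵘ z (D + D * suc D))
                                                            (cong₂ ℤ._+_ (ℤP.pos-* a (suc D)) (ℤP.pos-* b (suc D))) ⟨
  mkℚᵘ (ℤ.+ (a * suc D + b * suc D)) (D + D * suc D)   ≈⟨ mkℚᵘ-≃ (distrib a b (suc D)) ⟩
  mkℚᵘ (ℤ.+ (a + b)) D                                 ≈⟨ ℚᵘP.≃-sym (toℚᵘ-frac (a + b) D) ⟩
  toℚᵘ (frac (a + b) (suc D))                          ∎)
  where
  open ℚᵘP.≃-Reasoning
  distrib : ∀ a b s → (a * s + b * s) * s ≡ (a + b) * (s * s)
  distrib = solve-∀

½*frac : ∀ a b → ½ ℚ.* frac a (suc b) ≡ frac a (2 * suc b)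
½*frac a b = ℚP.toℚᵘ-injective (begin
  toℚᵘ (½ ℚ.* frac a (suc b))                ≈⟨ ℚP.toℚᵘ-homo-* ½ (frac a (suc b)) ⟩
  toℚᵘ ½ ℚᵘ.* toℚᵘ (frac a (suc b))          ≈⟨ ℚᵘP.*-congˡ {toℚᵘ ½} (toℚᵘ-frac a b) ⟩
  mkℚᵘ (ℤ.+ 1 ℤ.* ℤ.+ a) (b + 1 * suc b)     ≡⟨ cong (λ z → mkℚᵘ z (b + 1 * suc b)) (ℤP.*-identityˡ (ℤ.+ a)) ⟩
  mkℚᵘ (ℤ.+ a) (b + 1 * suc b)               ≈⟨ ℚᵘP.≃-sym (toℚᵘ-frac a (b + 1 * suc b)) ⟩
  toℚᵘ (frac a (2 * suc b))                  ∎)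
  where open ℚᵘP.≃-Reasoning

∣frac-frac∣-≤ : ∀ a b c d {X} → ℤ.∣ a * suc d ⊖ c * suc b ∣ ≤ X →
  ℚ.∣ frac a (suc b) ℚ.- frac c (suc d) ∣ ≤ℚ frac X (suc b * suc d)
∣frac-frac∣-≤ a b c d {X} ∣ad-cb∣≤X = ℚP.toℚᵘ-cancel-≤ (begin
  toℚᵘ (ℚ.∣ x ℚ.- y ∣)                              ≃⟨ ℚP.toℚᵘ-homo-∣-∣ (x ℚ.- y) ⟩
  ℚᵘ.∣ toℚᵘ (x ℚ.- y) ∣                             ≃⟨ ℚᵘP.∣-∣-cong toℚᵘ[x-y] ⟩
  ℚᵘ.∣ mkℚᵘ (ℤ.+ a) b ℚᵘ.- mkℚᵘ (ℤ.+ c) d ∣         ≤⟨ *≤* (subst (λ z → ℤ.+ ℤ.∣ z ∣ ℤ.* ℤ.+ S ℤ.≤ ℤ.+ X ℤ.* ℤ.+ S)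
                                                                (sym numerator) scaled) ⟩
  mkℚᵘ (ℤ.+ X) (d + b * suc d)                      ≃⟨ ℚᵘP.≃-sym (toℚᵘ-frac X (d + b * suc d)) ⟩
  toℚᵘ (frac X (suc b * suc d))                     ∎)
  where
  open ℚᵘP.≤-Reasoning
  x = frac a (suc b)
  y = frac c (suc d)
  S = suc b * suc d
  toℚᵘ[x-y] : toℚᵘ (x ℚ.- y) ℚᵘ.≃ mkℚᵘ (ℤ.+ a) b ℚᵘ.- mkℚᵘ (ℤ.+ c) d
  toℚᵘ[x-y] = ℚᵘP.≃-trans (ℚP.toℚᵘ-homo-+ x (ℚ.- y))
                (ℚᵘP.+-cong (toℚᵘ-frac a b) (ℚᵘP.≃-trans (ℚP.toℚᵘ-homo‿- y) (ℚᵘP.-‿cong (toℚᵘ-frac c d))))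
  numerator : ℤ.+ a ℤ.* ℤ.+ suc d ℤ.+ ℤ.- (ℤ.+ c) ℤ.* ℤ.+ suc b ≡ a * suc d ⊖ c * suc b
  numerator = trans (cong₂ ℤ._+_ (sym (ℤP.pos-* a (suc d)))
                                (trans (sym (ℤP.neg-distribˡ-* (ℤ.+ c) (ℤ.+ suc b))) (cong ℤ.-_ (sym (ℤP.pos-* c (suc b))))))
                    (ℤP.m-n≡m⊖n (a * suc d) (c * suc b))
  scaled : ℤ.+ ℤ.∣ a * suc d ⊖ c * suc b ∣ ℤ.* ℤ.+ S ℤ.≤ ℤ.+ X ℤ.* ℤ.+ S
  scaled = subst₂ ℤ._≤_ (ℤP.pos-* ℤ.∣ a * suc d ⊖ c * suc b ∣ S) (ℤP.pos-* X S) (+≤+ (*-monoˡ-≤ S ∣ad-cb∣≤X))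

-- The cross numerator (d + e)(1 + P) − d(1 + T) is e(1 + P) − d(T − P), and |T − P| ≤ M.
∣frac-+-frac∣-≤ : ∀ d e {T P M} → T ≤ P + M → P ≤ T + M →
  ℚ.∣ frac (d + e) (suc T) ℚ.- frac d (suc P) ∣ ≤ℚ frac (e * suc P + d * M) (suc T * suc P)
∣frac-+-frac∣-≤ d e {T} {P} {M} T≤P+M P≤T+M = ∣frac-frac∣-≤ (d + e) T d P (∣m⊖n∣≤o upper lower)
  where
  open ≤-Reasoning
  upper : (d + e) * suc P ≤ d * suc T + (e * suc P + d * M)
  upper = begin
    (d + e) * suc P             ≡⟨ *-distribʳ-+ (suc P) d e ⟩
    d * suc P + e * suc P       ≤⟨ +-monoˡ-≤ (e * suc P) (*-monoʳ-≤ d (s≤s P≤T+M)) ⟩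
    d * (suc T + M) + e * suc P ≡⟨ rearrange d e (suc T) (suc P) M ⟩
    d * suc T + (e * suc P + d * M) ∎
    where
    rearrange : ∀ d e t p m → d * (t + m) + e * p ≡ d * t + (e * p + d * m)
    rearrange = solve-∀
  lower : d * suc T ≤ (d + e) * suc P + (e * suc P + d * M)
  lower = begin
    d * suc T                                       ≤⟨ *-monoʳ-≤ d (s≤s T≤P+M) ⟩
    d * (suc P + M)                                 ≤⟨ m≤m+n (d * (suc P + M)) (e * suc P + e * suc P) ⟩
    d * (suc P + M) + (e * suc P + e * suc P)       ≡⟨ rearrange d e (suc P) M ⟩
    (d + e) * suc P + (e * suc P + d * M)           ∎
    where
    rearrange : ∀ d e p m → d * (p + m) + (e * p + e * p) ≡ (d + e) * p + (e * p + d * m)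
    rearrange = solve-∀

sumℚ-map-cong : ∀ {f g : B → ℚ} → (∀ H → f H ≡ g H) → ∀ Hs → sumℚ (map f Hs) ≡ sumℚ (map g Hs)
sumℚ-map-cong f≗g []       = refl
sumℚ-map-cong f≗g (H ∷ Hs) = cong₂ ℚ._+_ (f≗g H) (sumℚ-map-cong f≗g Hs)

sumℚ-map-mono : ∀ {f g : B → ℚ} → (∀ H → f H ≤ℚ g H) → ∀ Hs → sumℚ (map f Hs) ≤ℚ sumℚ (map g Hs)
sumℚ-map-mono f≤g []       = ℚP.≤-refl
sumℚ-map-mono f≤g (H ∷ Hs) = ℚP.+-mono-≤ (f≤g H) (sumℚ-map-mono f≤g Hs)

sumℚ-map-frac : ∀ (f : B → ℕ) D Hs → sumℚ (map (λ H → frac (f H) (suc D)) Hs) ≡ frac (sum (map f Hs)) (suc D)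
sumℚ-map-frac f D []       = sym (ℚP.0/n≡0 (suc D))
sumℚ-map-frac f D (H ∷ Hs) = trans (cong (frac (f H) (suc D) ℚ.+_) (sumℚ-map-frac f D Hs)) (frac-+ (f H) _ D)

sum-cross-≤ : ∀ (Hs : List B) (d e : B → ℕ) {N M} → sum (map d Hs) ≤ N → sum (map e Hs) ≤ M →
  sum (map (λ H → e H * N + d H * M) Hs) ≤ 2 * (M * N)
sum-cross-≤ Hs d e {N} {M} Σd≤N Σe≤M = begin
  sum (map (λ H → e H * N + d H * M) Hs)                  ≡⟨ sum-map-+ (λ H → e H * N) (λ H → d H * M) Hs ⟩
  sum (map (λ H → e H * N) Hs) + sum (map (λ H → d H * M) Hs)
                                                          ≡⟨ cong₂ _+_ (sum-map-*ʳ e N Hs) (sum-map-*ʳ d M Hs) ⟩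
  sum (map e Hs) * N + sum (map d Hs) * M                 ≤⟨ +-mono-≤ (*-monoˡ-≤ N Σe≤M) (*-monoˡ-≤ M Σd≤N) ⟩
  M * N + N * M                                           ≡⟨ double M N ⟩
  2 * (M * N)                                             ∎
  where
  open ≤-Reasoning
  double : ∀ m n → m * n + n * m ≡ 2 * (m * n)
  double = solve-∀

½-sum-∣frac-+-frac∣-≤ : ∀ (Hs : List B) (d e : B → ℕ) {T P M} → T ≤ P + M → P ≤ T + M →
  sum (map d Hs) ≤ suc P → sum (map e Hs) ≤ M →
  ½ ℚ.* sumℚ (map (λ H → ℚ.∣ frac (d H + e H) (suc T) ℚ.- frac (d H) (suc P) ∣) Hs) ≤ℚ frac M (suc T)
½-sum-∣frac-+-frac∣-≤ Hs d e {T} {P} {M} T≤P+M P≤T+M Σd≤P Σe≤M = begin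
  ½ ℚ.* sumℚ (map (λ H → ℚ.∣ frac (d H + e H) (suc T) ℚ.- frac (d H) (suc P) ∣) Hs)
    ≤⟨ ℚP.*-monoˡ-≤-nonNeg ½ (sumℚ-map-mono (λ H → ∣frac-+-frac∣-≤ (d H) (e H) T≤P+M P≤T+M) Hs) ⟩
  ½ ℚ.* sumℚ (map (λ H → frac (X H) (suc T * suc P)) Hs)
    ≡⟨ cong (½ ℚ.*_) (sumℚ-map-frac X (P + T * suc P) Hs) ⟩
  ½ ℚ.* frac (sum (map X Hs)) (suc T * suc P)
    ≡⟨ ½*frac (sum (map X Hs)) (P + T * suc P) ⟩
  frac (sum (map X Hs)) (2 * (suc T * suc P))
    ≤⟨ frac-mono-≤ (sum (map X Hs)) (2 * (suc T * suc P)) M (suc T) cross ⟩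
  frac M (suc T) ∎
  where
  open ℚP.≤-Reasoning
  X : _ → ℕ
  X H = e H * suc P + d H * M
  cross : sum (map X Hs) * suc T ≤ M * (2 * (suc T * suc P))
  cross = ≤-trans (*-monoˡ-≤ (suc T) (sum-cross-≤ Hs d e Σd≤P Σe≤M)) (≤-reflexive (reorder M (suc P) (suc T)))
    where
    reorder : ∀ m p t → 2 * (m * p) * t ≡ m * (2 * (t * p))
    reorder = solve-∀

½-sum-∣frac-+-frac∣-≤′ : ∀ (Hs : List B) (d e : B → ℕ) {T N M} → suc T ≡ N + M → (∀ H → d H ≤ N) →
  sum (map d Hs) ≤ N → sum (map e Hs) ≤ M →
  ½ ℚ.* sumℚ (map (λ H → ℚ.∣ frac (d H + e H) (suc T) ℚ.- frac (d H) N ∣) Hs) ≤ℚ frac M (suc T)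
-- For N = 0 every frac (d H) N is the junk value 0, which is frac 0 1 = frac (d H) 1.
½-sum-∣frac-+-frac∣-≤′ Hs d e {T} {zero} {M} refl d≤0 Σd≤0 Σe≤M = begin
  ½ ℚ.* sumℚ (map (λ H → ℚ.∣ frac (d H + e H) (suc T) ℚ.- frac (d H) 0 ∣) Hs)
    ≡⟨ cong (½ ℚ.*_) (sumℚ-map-cong (λ H → cong (λ x → ℚ.∣ frac (d H + e H) (suc T) ℚ.- frac x 1 ∣)
                                                   (n≤0⇒n≡0 (d≤0 H))) Hs) ⟨
  ½ ℚ.* sumℚ (map (λ H → ℚ.∣ frac (d H + e H) (suc T) ℚ.- frac (d H) 1 ∣) Hs)
    ≤⟨ ½-sum-∣frac-+-frac∣-≤ Hs d e (n≤1+n T) z≤n (≤-trans Σd≤0 z≤n) Σe≤M ⟩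
  frac M (suc T) ∎
  where open ℚP.≤-Reasoning
½-sum-∣frac-+-frac∣-≤′ Hs d e {T} {suc P} {M} refl _ Σd≤N Σe≤M =
  ½-sum-∣frac-+-frac∣-≤ Hs d e ≤-refl (≤-trans (m≤m+n P M) (m≤m+n (P + M) M)) Σd≤N Σe≤M

frequency : (A → Bool) → List A → ℚ
frequency p xs = frac (count p xs) (length xs)

½-sum-∣frequency-frequency-filter∣-≤ : ∀ (Hs : List B) (p : B → A → Bool) (g : A → Bool) xs →
  (∀ x → count (λ H → p H x) Hs ≤ 1) →
  ½ ℚ.* sumℚ (map (λ H → ℚ.∣ frequency (p H) xs ℚ.- frequency (p H) (filterᵇ g xs) ∣) Hs)
    ≤ℚ frequency (not ∘ g) xs
½-sum-∣frequency-frequency-filter∣-≤ Hs p g [] _ = ℚP.≤-reflexive (cong (½ ℚ.*_) (sumℚ-zero Hs))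
  where
  sumℚ-zero : ∀ Hs → sumℚ (map (λ (_ : B) → ℚ.0ℚ) Hs) ≡ ℚ.0ℚ
  sumℚ-zero []       = refl
  sumℚ-zero (_ ∷ Hs) = cong (ℚ.0ℚ ℚ.+_) (sumℚ-zero Hs)
½-sum-∣frequency-frequency-filter∣-≤ Hs p g xs@(_ ∷ _) ≤1 = begin
  ½ ℚ.* sumℚ (map (λ H → ℚ.∣ frequency (p H) xs ℚ.- frequency (p H) (filterᵇ g xs) ∣) Hs)
    ≡⟨ cong (½ ℚ.*_) (sumℚ-map-cong (λ H → cong (λ c → ℚ.∣ frac c (length xs) ℚ.- frac (d H) (count g xs) ∣)
                                                   (count-filter-split (p H) g xs)) Hs) ⟩
  ½ ℚ.* sumℚ (map (λ H → ℚ.∣ frac (d H + e H) (length xs) ℚ.- frac (d H) (count g xs) ∣) Hs)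
    ≤⟨ ½-sum-∣frac-+-frac∣-≤′ Hs d e (length-filter-split g xs) (λ H → count-≤-length (p H) (filterᵇ g xs))
         (sum-count-≤-length p Hs (filterᵇ g xs) ≤1) (sum-count-≤-length p Hs (filterᵇ (not ∘ g) xs) ≤1) ⟩
  frequency (not ∘ g) xs ∎
  where
  open ℚP.≤-Reasoning
  d e : _ → ℕ
  d H = count (p H) (filterᵇ g xs)
  e H = count (p H) (filterᵇ (not ∘ g) xs)

-- Binomial coefficients and subsets

C-suc : ∀ n k → suc n C suc k ≡ n C k + n C suc k
C-suc n k = sym (nCk+nC[k+1]≡[n+1]C[k+1] n k)

length-subsets : ∀ q n → length (subsets q n) ≡ n C q
length-subsets zero    n       = refl
length-subsets (suc q) zero    = refl
length-subsets (suc q) (suc n) = begin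
  length (subsets (suc q) n ++ map (_∷ʳ n) (subsets q n))   ≡⟨ length-++ (subsets (suc q) n) ⟩
  length (subsets (suc q) n) + length (map (_∷ʳ n) (subsets q n))
                                                            ≡⟨ cong (length (subsets (suc q) n) +_) (length-map (_∷ʳ n) (subsets q n)) ⟩
  length (subsets (suc q) n) + length (subsets q n)         ≡⟨ cong₂ _+_ (length-subsets (suc q) n) (length-subsets q n) ⟩
  n C suc q + n C q                                         ≡⟨ +-comm (n C suc q) (n C q) ⟩
  n C q + n C suc q                                         ≡⟨ C-suc n q ⟨
  suc n C suc q                                             ∎
  where open ≡-Reasoning

[1+n]C[1+k]*[1+k]≡[1+n]*nCk : ∀ n k → (suc n C suc k) * suc k ≡ suc n * (n C k)
[1+n]C[1+k]*[1+k]≡[1+n]*nCk zero    zero    = refl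
[1+n]C[1+k]*[1+k]≡[1+n]*nCk zero    (suc k) = refl
[1+n]C[1+k]*[1+k]≡[1+n]*nCk (suc n) zero    = begin
  (suc (suc n) C 1) * 1  ≡⟨ *-identityʳ (suc (suc n) C 1) ⟩
  suc (suc n) C 1        ≡⟨ nC1≡n (suc (suc n)) ⟩
  suc (suc n)            ≡⟨ *-identityʳ (suc (suc n)) ⟨
  suc (suc n) * 1        ∎
  where open ≡-Reasoning
[1+n]C[1+k]*[1+k]≡[1+n]*nCk (suc n) (suc k) = begin
  (suc (suc n) C suc (suc k)) * suc (suc k)
    ≡⟨ cong (_* suc (suc k)) (C-suc (suc n) (suc k)) ⟩
  (x + y) * suc (suc k)
    ≡⟨ expand x y (suc k) ⟩
  x * suc k + y * suc (suc k) + x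
    ≡⟨ cong₂ (λ a b → a + b + x) ([1+n]C[1+k]*[1+k]≡[1+n]*nCk n k) ([1+n]C[1+k]*[1+k]≡[1+n]*nCk n (suc k)) ⟩
  suc n * (n C k) + suc n * (n C suc k) + x
    ≡⟨ cong (suc n * (n C k) + suc n * (n C suc k) +_) (C-suc n k) ⟩
  suc n * (n C k) + suc n * (n C suc k) + (n C k + n C suc k)
    ≡⟨ collect (suc n) (n C k) (n C suc k) ⟩
  suc (suc n) * (n C k + n C suc k)
    ≡⟨ cong (suc (suc n) *_) (C-suc n k) ⟨
  suc (suc n) * (suc n C suc k) ∎
  where
  open ≡-Reasoning
  x = suc n C suc k
  y = suc n C suc (suc k)
  expand : ∀ x y k → (x + y) * suc k ≡ x * k + y * suc k + x
  expand = solve-∀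
  collect : ∀ m a b → m * a + m * b + (a + b) ≡ suc m * (a + b)
  collect = solve-∀

n[n∸1]*[n∸2]Cq≡[2+q][1+q]*nC[2+q] : ∀ n q → n * (n ∸ 1) * ((n ∸ 2) C q) ≡ suc (suc q) * suc q * (n C suc (suc q))
n[n∸1]*[n∸2]Cq≡[2+q][1+q]*nC[2+q] zero          q = sym (*-zeroʳ (suc (suc q) * suc q))
n[n∸1]*[n∸2]Cq≡[2+q][1+q]*nC[2+q] (suc zero)    q = sym (*-zeroʳ (suc (suc q) * suc q))
n[n∸1]*[n∸2]Cq≡[2+q][1+q]*nC[2+q] (suc (suc m)) q = begin
  suc (suc m) * suc m * (m C q)                         ≡⟨ *-assoc (suc (suc m)) (suc m) (m C q) ⟩
  suc (suc m) * (suc m * (m C q))                       ≡⟨ cong (suc (suc m) *_) ([1+n]C[1+k]*[1+k]≡[1+n]*nCk m q) ⟨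
  suc (suc m) * ((suc m C suc q) * suc q)               ≡⟨ *-assoc (suc (suc m)) (suc m C suc q) (suc q) ⟨
  suc (suc m) * (suc m C suc q) * suc q                 ≡⟨ cong (_* suc q) ([1+n]C[1+k]*[1+k]≡[1+n]*nCk (suc m) (suc q)) ⟨
  (suc (suc m) C suc (suc q)) * suc (suc q) * suc q     ≡⟨ rotate (suc (suc m) C suc (suc q)) (suc (suc q)) (suc q) ⟩
  suc (suc q) * suc q * (suc (suc m) C suc (suc q))     ∎
  where
  open ≡-Reasoning
  rotate : ∀ x a b → x * a * b ≡ a * b * x
  rotate = solve-∀

sumBelow : (ℕ → ℕ) → ℕ → ℕ
sumBelow h zero    = 0
sumBelow h (suc n) = sumBelow h n + h n

countBelow : (ℕ → Bool) → ℕ → ℕ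
countBelow g = sumBelow (indicator ∘ g)

sum-subsets-suc : ∀ (f : List ℕ → ℕ) q n →
  sum (map f (subsets (suc q) (suc n))) ≡ sum (map f (subsets (suc q) n)) + sum (map (f ∘ (_∷ʳ n)) (subsets q n))
sum-subsets-suc f q n = begin
  sum (map f (subsets (suc q) n ++ map (_∷ʳ n) (subsets q n)))
    ≡⟨ cong sum (map-++ f (subsets (suc q) n) (map (_∷ʳ n) (subsets q n))) ⟩
  sum (map f (subsets (suc q) n) ++ map f (map (_∷ʳ n) (subsets q n)))
    ≡⟨ sum-++ (map f (subsets (suc q) n)) _ ⟩
  sum (map f (subsets (suc q) n)) + sum (map f (map (_∷ʳ n) (subsets q n)))
    ≡⟨ cong (λ ys → sum (map f (subsets (suc q) n)) + sum ys) (map-∘ (subsets q n)) ⟨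
  sum (map f (subsets (suc q) n)) + sum (map (f ∘ (_∷ʳ n)) (subsets q n)) ∎
  where open ≡-Reasoning

sum-count-subsets : ∀ (g : ℕ → Bool) q n → sum (map (count g) (subsets (suc q) n)) ≡ countBelow g n * ((n ∸ 1) C q)
sum-count-subsets g q zero    = refl
sum-count-subsets g q (suc m) = begin
  sum (map (count g) (subsets (suc q) (suc m)))
    ≡⟨ sum-subsets-suc (count g) q m ⟩
  sum (map (count g) (subsets (suc q) m)) + sum (map (count g ∘ (_∷ʳ m)) (subsets q m))
    ≡⟨ cong₂ _+_ (sum-count-subsets g q m) (sum-map-cong (λ xs → count-∷ʳ g xs m) (subsets q m)) ⟩
  countBelow g m * ((m ∸ 1) C q) + sum (map (λ xs → count g xs + i) (subsets q m))
    ≡⟨ cong (countBelow g m * ((m ∸ 1) C q) +_) (begin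
         sum (map (λ xs → count g xs + i) (subsets q m))                 ≡⟨ sum-map-+ (count g) (λ _ → i) (subsets q m) ⟩
         sum (map (count g) (subsets q m)) + sum (map (λ _ → i) (subsets q m))
                                                                         ≡⟨ cong (sum (map (count g) (subsets q m)) +_)
                                                                              (trans (sum-map-const i (subsets q m))
                                                                                     (cong (_* i) (length-subsets q m))) ⟩
         sum (map (count g) (subsets q m)) + (m C q) * i                 ∎) ⟩
  countBelow g m * ((m ∸ 1) C q) + (sum (map (count g) (subsets q m)) + (m C q) * i)
    ≡⟨ pascal q m ⟩
  (countBelow g m + i) * (m C q) ∎
  where
  open ≡-Reasoning
  i = indicator (g m)
  pascal : ∀ q′ m′ → countBelow g m′ * ((m′ ∸ 1) C q′) + (sum (map (count g) (subsets q′ m′)) + (m′ C q′) * i)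
                     ≡ (countBelow g m′ + i) * (m′ C q′)
  pascal zero     m′       = finish (countBelow g m′) i
    where
    finish : ∀ c i → c * 1 + (0 + 1 * i) ≡ (c + i) * 1
    finish = solve-∀
  pascal (suc q′) zero     = sym (*-zeroʳ i)
  pascal (suc q′) (suc l)  = begin
    c * (l C suc q′) + (sum (map (count g) (subsets (suc q′) (suc l))) + (suc l C suc q′) * i)
      ≡⟨ cong₂ (λ s x → c * (l C suc q′) + (s + x * i)) (sum-count-subsets g q′ (suc l)) (C-suc l q′) ⟩
    c * (l C suc q′) + (c * (l C q′) + (l C q′ + l C suc q′) * i)
      ≡⟨ collect c (l C q′) (l C suc q′) i ⟩
    (c + i) * (l C q′ + l C suc q′)
      ≡⟨ cong ((c + i) *_) (C-suc l q′) ⟨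
    (c + i) * (suc l C suc q′) ∎
    where
    c = countBelow g (suc l)
    collect : ∀ c a b i → c * b + (c * a + (a + b) * i) ≡ (c + i) * (a + b)
    collect = solve-∀

countPairs : (ℕ → ℕ → Bool) → List ℕ → ℕ
countPairs r xs = count (uncurry r) (pairs xs)

pairsBelow : (ℕ → ℕ → Bool) → ℕ → ℕ
pairsBelow r = sumBelow (λ b → countBelow (λ a → r a b) b)

countPairs-∷ : ∀ r x xs → countPairs r (x ∷ xs) ≡ count (r x) xs + countPairs r xs
countPairs-∷ r x xs = trans (count-++ (uncurry r) (map (x ,_) xs) (pairs xs))
                            (cong (_+ countPairs r xs) (count-map (uncurry r) (x ,_) xs))

countPairs-∷ʳ : ∀ r xs y → countPairs r (xs ∷ʳ y) ≡ countPairs r xs + count (λ a → r a y) xs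
countPairs-∷ʳ r []       y = refl
countPairs-∷ʳ r (x ∷ xs) y = begin
  countPairs r (x ∷ (xs ∷ʳ y))                                     ≡⟨ countPairs-∷ r x (xs ∷ʳ y) ⟩
  count (r x) (xs ∷ʳ y) + countPairs r (xs ∷ʳ y)                   ≡⟨ cong₂ _+_ (count-∷ʳ (r x) xs y) (countPairs-∷ʳ r xs y) ⟩
  (count (r x) xs + indicator (r x y)) + (countPairs r xs + count (λ a → r a y) xs)
                                                                   ≡⟨ +-interchange (count (r x) xs) _ _ _ ⟩
  (count (r x) xs + countPairs r xs) + (indicator (r x y) + count (λ a → r a y) xs)
                                                                   ≡⟨ cong₂ _+_ (countPairs-∷ r x xs) (count-∷ (λ a → r a y) x xs) ⟨
  countPairs r (x ∷ xs) + count (λ a → r a y) (x ∷ xs)             ∎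
  where open ≡-Reasoning

sum-countPairs-subsets-1 : ∀ r n → sum (map (countPairs r) (subsets 1 n)) ≡ 0
sum-countPairs-subsets-1 r zero    = refl
sum-countPairs-subsets-1 r (suc n) = trans (sum-subsets-suc (countPairs r) 0 n) (cong (_+ 0) (sum-countPairs-subsets-1 r n))

sum-countPairs-subsets : ∀ r q n → sum (map (countPairs r) (subsets (suc (suc q)) n)) ≡ pairsBelow r n * ((n ∸ 2) C q)
sum-countPairs-subsets r q zero    = refl
sum-countPairs-subsets r q (suc m) = begin
  sum (map (countPairs r) (subsets (suc (suc q)) (suc m)))
    ≡⟨ sum-subsets-suc (countPairs r) (suc q) m ⟩
  sum (map (countPairs r) (subsets (suc (suc q)) m)) + sum (map (countPairs r ∘ (_∷ʳ m)) (subsets (suc q) m))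
    ≡⟨ cong₂ _+_ (sum-countPairs-subsets r q m) (sum-map-cong (λ xs → countPairs-∷ʳ r xs m) (subsets (suc q) m)) ⟩
  pairsBelow r m * ((m ∸ 2) C q) + sum (map (λ xs → countPairs r xs + count (λ a → r a m) xs) (subsets (suc q) m))
    ≡⟨ cong (pairsBelow r m * ((m ∸ 2) C q) +_) (trans (sum-map-+ (countPairs r) (count (λ a → r a m)) (subsets (suc q) m))
                                                      (cong (sum (map (countPairs r) (subsets (suc q) m)) +_)
                                                            (sum-count-subsets (λ a → r a m) q m))) ⟩
  pairsBelow r m * ((m ∸ 2) C q) + (sum (map (countPairs r) (subsets (suc q) m)) + new * ((m ∸ 1) C q))
    ≡⟨ pascal q m ⟩
  (pairsBelow r m + new) * ((m ∸ 1) C q) ∎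
  where
  open ≡-Reasoning
  new = countBelow (λ a → r a m) m
  pascal : ∀ q′ m′ → pairsBelow r m′ * ((m′ ∸ 2) C q′)
                       + (sum (map (countPairs r) (subsets (suc q′) m′)) + new * ((m′ ∸ 1) C q′))
                     ≡ (pairsBelow r m′ + new) * ((m′ ∸ 1) C q′)
  pascal zero     m′ = begin
    pairsBelow r m′ * 1 + (sum (map (countPairs r) (subsets 1 m′)) + new * 1)
      ≡⟨ cong (λ s → pairsBelow r m′ * 1 + (s + new * 1)) (sum-countPairs-subsets-1 r m′) ⟩
    pairsBelow r m′ * 1 + (0 + new * 1)
      ≡⟨ finish (pairsBelow r m′) new ⟩
    (pairsBelow r m′ + new) * 1 ∎
    where
    finish : ∀ p c → p * 1 + (0 + c * 1) ≡ (p + c) * 1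
    finish = solve-∀
  pascal (suc q′) zero          = refl
  pascal (suc q′) (suc zero)    = refl
  pascal (suc q′) (suc (suc l)) = begin
    p * (l C suc q′) + (sum (map (countPairs r) (subsets (suc (suc q′)) (suc (suc l)))) + new * (suc l C suc q′))
      ≡⟨ cong₂ (λ s x → p * (l C suc q′) + (s + new * x)) (sum-countPairs-subsets r q′ (suc (suc l))) (C-suc l q′) ⟩
    p * (l C suc q′) + (p * (l C q′) + new * (l C q′ + l C suc q′))
      ≡⟨ collect p (l C q′) (l C suc q′) new ⟩
    (p + new) * (l C q′ + l C suc q′)
      ≡⟨ cong ((p + new) *_) (C-suc l q′) ⟨
    (p + new) * (suc l C suc q′) ∎
    where
    p = pairsBelow r (suc (suc l))
    collect : ∀ p a b c → p * b + (p * a + c * (a + b)) ≡ (p + c) * (a + b)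
    collect = solve-∀

-- Pairs inside the intervals of a partition

sumBelow-+ : ∀ h m c → sumBelow h (m + c) ≡ sumBelow h m + sumBelow (λ j → h (m + j)) c
sumBelow-+ h m zero    = trans (cong (sumBelow h) (+-identityʳ m)) (sym (+-identityʳ (sumBelow h m)))
sumBelow-+ h m (suc c) = begin
  sumBelow h (m + suc c)                                        ≡⟨ cong (sumBelow h) (+-suc m c) ⟩
  sumBelow h (m + c) + h (m + c)                                ≡⟨ cong (_+ h (m + c)) (sumBelow-+ h m c) ⟩
  sumBelow h m + sumBelow (λ j → h (m + j)) c + h (m + c)       ≡⟨ +-assoc (sumBelow h m) _ _ ⟩
  sumBelow h m + sumBelow (λ j → h (m + j)) (suc c)             ∎
  where open ≡-Reasoning

sumBelow-cong : ∀ {f g} m → (∀ a → a < m → f a ≡ g a) → sumBelow f m ≡ sumBelow g m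
sumBelow-cong zero    _   = refl
sumBelow-cong (suc m) f≗g = cong₂ _+_ (sumBelow-cong m (λ a a<m → f≗g a (m<n⇒m<1+n a<m))) (f≗g m ≤-refl)

sumBelow-const : ∀ c m → sumBelow (λ _ → c) m ≡ m * c
sumBelow-const c zero    = refl
sumBelow-const c (suc m) = trans (cong (_+ c) (sumBelow-const c m)) (+-comm (m * c) c)

2*sumBelow-id : ∀ m → 2 * sumBelow (λ b → b) m ≡ m * (m ∸ 1)
2*sumBelow-id zero          = refl
2*sumBelow-id (suc zero)    = refl
2*sumBelow-id (suc (suc m)) = begin
  2 * (sumBelow (λ b → b) (suc m) + suc m)         ≡⟨ *-distribˡ-+ 2 (sumBelow (λ b → b) (suc m)) (suc m) ⟩
  2 * sumBelow (λ b → b) (suc m) + 2 * suc m       ≡⟨ cong (_+ 2 * suc m) (2*sumBelow-id (suc m)) ⟩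
  suc m * m + 2 * suc m                            ≡⟨ triangle m ⟩
  suc (suc m) * suc m                              ∎
  where
  open ≡-Reasoning
  triangle : ∀ m → suc m * m + 2 * suc m ≡ suc (suc m) * suc m
  triangle = solve-∀

blockOf-head : ∀ sz szs a → a < sz → blockOf (sz ∷ szs) a ≡ 0
blockOf-head sz szs a a<sz rewrite Equivalence.to T-≡ (<⇒<ᵇ a<sz) = refl

blockOf-tail : ∀ sz szs j → blockOf (sz ∷ szs) (sz + j) ≡ suc (blockOf szs j)
blockOf-tail sz szs j =
  trans (cong (λ b → if b then 0 else suc (blockOf szs (sz + j ∸ sz))) (m+n≮ᵇm sz j))
        (cong (suc ∘ blockOf szs) (m+n∸m≡n sz j))
  where
  m+n≮ᵇm : ∀ m n → (m + n <ᵇ m) ≡ false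
  m+n≮ᵇm zero    n = refl
  m+n≮ᵇm (suc m) n = m+n≮ᵇm m n

sameBlock : (ℕ → ℕ) → ℕ → ℕ → Bool
sameBlock β a b = does (β a ≟ β b)

countBelow-const : ∀ (g : ℕ → Bool) b m → (∀ a → a < m → g a ≡ b) → countBelow g m ≡ m * indicator b
countBelow-const g b m g≡b = trans (sumBelow-cong m (λ a a<m → cong indicator (g≡b a a<m))) (sumBelow-const (indicator b) m)

pairsBelow-sameBlock-∷ : ∀ sz szs c →
  pairsBelow (sameBlock (blockOf (sz ∷ szs))) (sz + c) ≡ sumBelow (λ b → b) sz + pairsBelow (sameBlock (blockOf szs)) c
pairsBelow-sameBlock-∷ sz szs c = trans (sumBelow-+ _ sz c) (cong₂ _+_ head tail)
  where
  β = blockOf (sz ∷ szs)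
  head : sumBelow (λ b → countBelow (λ a → sameBlock β a b) b) sz ≡ sumBelow (λ b → b) sz
  head = sumBelow-cong sz (λ b b<sz → trans
    (countBelow-const _ true b (λ a a<b →
      cong₂ (λ x y → does (x ≟ y)) (blockOf-head sz szs a (<-trans a<b b<sz)) (blockOf-head sz szs b b<sz)))
    (*-identityʳ b))
  tail : sumBelow (λ j → countBelow (λ a → sameBlock β a (sz + j)) (sz + j)) c ≡ pairsBelow (sameBlock (blockOf szs)) c
  tail = sumBelow-cong c (λ j _ → trans (sumBelow-+ _ sz j) (cong₂ _+_
    (trans (countBelow-const _ false sz (λ a a<sz →
             cong₂ (λ x y → does (x ≟ y)) (blockOf-head sz szs a a<sz) (blockOf-tail sz szs j))) (*-zeroʳ sz))
    (sumBelow-cong j (λ a _ → cong indicator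
      (cong₂ (λ x y → does (x ≟ y)) (blockOf-tail sz szs a) (blockOf-tail sz szs j))))))

2*pairsBelow-sameBlock : ∀ szs → 2 * pairsBelow (sameBlock (blockOf szs)) (sum szs) ≡ sum (map (λ z → z * (z ∸ 1)) szs)
2*pairsBelow-sameBlock []         = refl
2*pairsBelow-sameBlock (sz ∷ szs) = begin
  2 * pairsBelow (sameBlock (blockOf (sz ∷ szs))) (sz + sum szs)
    ≡⟨ cong (2 *_) (pairsBelow-sameBlock-∷ sz szs (sum szs)) ⟩
  2 * (sumBelow (λ b → b) sz + pairsBelow (sameBlock (blockOf szs)) (sum szs))
    ≡⟨ *-distribˡ-+ 2 (sumBelow (λ b → b) sz) _ ⟩
  2 * sumBelow (λ b → b) sz + 2 * pairsBelow (sameBlock (blockOf szs)) (sum szs)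
    ≡⟨ cong₂ _+_ (2*sumBelow-id sz) (2*pairsBelow-sameBlock szs) ⟩
  sz * (sz ∸ 1) + sum (map (λ z → z * (z ∸ 1)) szs) ∎
  where open ≡-Reasoning

-- r blocks of size m + 1 and j blocks of size m: k Σ s(s − 1) ≤ n(n − 1) with k = r + j and n = Σ s.
equipartition-≤ : ∀ r j m → 1 ≤ r + j →
  (r + j) * (r * (suc m * m) + j * (m * (m ∸ 1))) ≤ (r + m * (r + j)) * (r + m * (r + j) ∸ 1)
equipartition-≤ r       j       zero     _ = ≤-trans (≤-reflexive (vanish r j)) z≤n
  where
  vanish : ∀ r j → (r + j) * (r * 0 + j * 0) ≡ 0
  vanish = solve-∀
equipartition-≤ (suc r) j       (suc m)  _ = ≤-trans (m≤m+n _ _) (≤-reflexive (slack r j m))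
  where
  slack : ∀ r j m → (suc r + j) * (suc r * (suc (suc m) * suc m) + j * (suc m * m))
                      + (suc r * r + (suc r + j) * suc m * (r + j))
                    ≡ (suc r + suc m * (suc r + j)) * (r + suc m * (suc r + j))
  slack = solve-∀
equipartition-≤ zero    zero    (suc m)  ()
equipartition-≤ zero    (suc j) (suc m)  _ = ≤-trans (m≤m+n _ _) (≤-reflexive (slack j m))
  where
  slack : ∀ j m → suc j * (0 * (suc (suc m) * suc m) + suc j * (suc m * m)) + suc j * suc m * j
                  ≡ (0 + suc m * suc j) * (j + m * suc j)
  slack = solve-∀

2*k*pairsBelow-sameBlock-≤ : ∀ k n .{{_ : NonZero k}} → 2 * k * pairsBelow (sameBlock (block k n)) n ≤ n * (n ∸ 1)
2*k*pairsBelow-sameBlock-≤ k n = begin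
  2 * k * pairsBelow (sameBlock (block k n)) n     ≡⟨ *-assoc 2 k _ ⟩
  2 * (k * pairsBelow (sameBlock (block k n)) n)   ≡⟨ *-exchange 2 k _ ⟩
  k * (2 * pairsBelow (sameBlock (block k n)) n)   ≡⟨ cong (λ x → k * (2 * pairsBelow (sameBlock (block k n)) x)) Σsizes≡n ⟨
  k * (2 * pairsBelow (sameBlock (block k n)) (sum sizes))
                                                   ≡⟨ cong (k *_) (2*pairsBelow-sameBlock sizes) ⟩
  k * sum (map (λ z → z * (z ∸ 1)) sizes)          ≡⟨ cong₂ _*_ (sym r+j≡k) Σs[s∸1] ⟩
  (r + j) * (r * (suc m * m) + j * (m * (m ∸ 1)))  ≤⟨ equipartition-≤ r j m (subst (1 ≤_) (sym r+j≡k) (>-nonZero⁻¹ k)) ⟩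
  (r + m * (r + j)) * (r + m * (r + j) ∸ 1)        ≡⟨ cong (λ x → x * (x ∸ 1)) n≡ ⟩
  n * (n ∸ 1)                                      ∎
  where
  open ≤-Reasoning
  r = n % k
  m = n / k
  j = k ∸ r
  sizes = intervalSizes k n
  r+j≡k : r + j ≡ k
  r+j≡k = m+[n∸m]≡n (<⇒≤ (m%n<n n k))
  n≡ : r + m * (r + j) ≡ n
  n≡ = trans (cong (λ x → r + m * x) r+j≡k) (sym (m≡m%n+[m/n]*n n k))
  Σsizes≡n : sum sizes ≡ n
  Σsizes≡n = begin-equality
    sum (replicate r (suc m) ++ replicate j m)          ≡⟨ sum-++ (replicate r (suc m)) (replicate j m) ⟩
    sum (replicate r (suc m)) + sum (replicate j m)     ≡⟨ cong₂ _+_ (sum-replicate r (suc m)) (sum-replicate j m) ⟩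
    r * suc m + j * m                                   ≡⟨ regroup r j m ⟩
    r + m * (r + j)                                     ≡⟨ n≡ ⟩
    n                                                   ∎
    where
    regroup : ∀ r j m → r * suc m + j * m ≡ r + m * (r + j)
    regroup = solve-∀
  Σs[s∸1] : sum (map (λ z → z * (z ∸ 1)) sizes) ≡ r * (suc m * m) + j * (m * (m ∸ 1))
  Σs[s∸1] = begin-equality
    sum (map f (replicate r (suc m) ++ replicate j m))            ≡⟨ cong sum (map-++ f (replicate r (suc m)) (replicate j m)) ⟩
    sum (map f (replicate r (suc m)) ++ map f (replicate j m))    ≡⟨ sum-++ (map f (replicate r (suc m))) _ ⟩
    sum (map f (replicate r (suc m))) + sum (map f (replicate j m))
                                                                  ≡⟨ cong₂ (λ xs ys → sum xs + sum ys)
                                                                       (map-replicate f r (suc m)) (map-replicate f j m) ⟩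
    sum (replicate r (f (suc m))) + sum (replicate j (f m))       ≡⟨ cong₂ _+_ (sum-replicate r _) (sum-replicate j _) ⟩
    r * (suc m * m) + j * (m * (m ∸ 1))                           ∎
    where
    f : ℕ → ℕ
    f z = z * (z ∸ 1)

count-nonSeparated-≤ : ∀ k q n .{{_ : NonZero k}} → count (not ∘ separated k n) (subsets q n) * (2 * k) ≤ q * q * (n C q)
count-nonSeparated-≤ k q n = ≤-trans (*-monoˡ-≤ (2 * k) nonSeparated≤) (bound q)
  where
  r = sameBlock (block k n)
  nonSeparated≤ : count (not ∘ separated k n) (subsets q n) ≤ sum (map (countPairs r) (subsets q n))
  nonSeparated≤ = count-≤-sum (λ xs → ≤-trans (not-all-≤-count _ (pairs xs))
                                             (≤-reflexive (count-cong (λ _ → not-involutive _) (pairs xs)))) (subsets q n)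
  bound : ∀ q → sum (map (countPairs r) (subsets q n)) * (2 * k) ≤ q * q * (n C q)
  bound zero          = z≤n
  bound (suc zero)    = ≤-trans (≤-reflexive (cong (_* (2 * k)) (sum-countPairs-subsets-1 r n))) z≤n
  bound (suc (suc q)) = begin
    sum (map (countPairs r) (subsets (suc (suc q)) n)) * (2 * k)
      ≡⟨ cong (_* (2 * k)) (sum-countPairs-subsets r q n) ⟩
    pairsBelow r n * ((n ∸ 2) C q) * (2 * k)
      ≡⟨ rotate (pairsBelow r n) ((n ∸ 2) C q) (2 * k) ⟩
    2 * k * pairsBelow r n * ((n ∸ 2) C q)
      ≤⟨ *-monoˡ-≤ ((n ∸ 2) C q) (2*k*pairsBelow-sameBlock-≤ k n) ⟩
    n * (n ∸ 1) * ((n ∸ 2) C q)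
      ≡⟨ n[n∸1]*[n∸2]Cq≡[2+q][1+q]*nC[2+q] n q ⟩
    suc (suc q) * suc q * (n C suc (suc q))
      ≤⟨ *-monoˡ-≤ (n C suc (suc q)) (*-monoʳ-≤ (suc (suc q)) (n≤1+n (suc q))) ⟩
    suc (suc q) * suc (suc q) * (n C suc (suc q)) ∎
    where
    open ≤-Reasoning
    rotate : ∀ p c k → p * c * k ≡ k * p * c
    rotate = solve-∀

mainTheorem15 : (s n q k : ℕ) → .{{_ : NonZero k}} → (G : ColGraph s) →
    q ≤ n → q ≤ k →
    statDist k q n G ≤ℚ frac (q * q) (2 * k)
mainTheorem15 s n q k@(suc _) G _ _ = begin
  statDist k q n G
    ≡⟨ cong (λ T → ½ ℚ.* sumℚ (map (λ H → ℚ.∣ frac (count (isCopy G H) S) T ℚ.- tk k q n H G ∣) (𝓗 s q)))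
            (length-subsets q n) ⟨
  ½ ℚ.* sumℚ (map (λ H → ℚ.∣ frequency (isCopy G H) S ℚ.- frequency (isCopy G H) (filterᵇ (separated k n) S) ∣) (𝓗 s q))
    ≤⟨ ½-sum-∣frequency-frequency-filter∣-≤ (𝓗 s q) (isCopy G) (separated k n) S uniqueCopy ⟩
  frequency (not ∘ separated k n) S
    ≤⟨ frac-mono-≤ (count (not ∘ separated k n) S) (length S) (q * q) (2 * k) nonSeparated ⟩
  frac (q * q) (2 * k) ∎
  where
  open ℚP.≤-Reasoning
  S = subsets q n
  uniqueCopy : ∀ xs → count (λ H → isCopy G H xs) (𝓗 s q) ≤ 1
  uniqueCopy xs = count-≡ʷ-words-≤1 (q C 2) (induced G xs)
  nonSeparated : count (not ∘ separated k n) S * (2 * k) ≤ q * q * length S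
  nonSeparated = subst (λ T → count (not ∘ separated k n) S * (2 * k) ≤ q * q * T)
                       (sym (length-subsets q n)) (count-nonSeparated-≤ k q n)
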